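{- Let $a, b \geq 1$ be natural numbers with at least one of $a, b$ greater than $1$. Then for all $n \in \mathbb{N}$, $$s_{a,b}(n) \leq s_{1,1}(n) = n+1,$$ and $s_{a,b}(n) = s_{1,1}(n)$ holds only if $n = 0$.
   Context: $\mathbb{N}$ denotes the natural numbers including $0$. For $a, b \geq 1$, $(s_{a,b}(n))_{n \geq 0}$ is the sequence whose generating function is $f_{a,b}(z) = \dfrac{1}{(z^a-1)(z^b-1)}$, i.e. $f_{a,b}(z) = \sum_{n \geq 0} s_{a,b}(n) z^n$ as a power series expansion at $z=0$. -}

module Defs where

open import Data.Nat using (ℕ; zero; suc; _+_; _*_; _∸_)
open import Data.Nat.Divisibility using (_∣?_)
open import Data.List using (List; upTo; map)
open import Data.Nat.ListAction using (sum)
open import Data.Bool using (if_then_else_)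
open import Relation.Nullary using (does)

-- Coefficient of z^k in the power series 1/(1 - z^a) = Σ_{m ≥ 0} z^(a m):
-- it is 1 if a divides k, and 0 otherwise.
geomCoeff : ℕ → ℕ → ℕ
geomCoeff a k = if does (a ∣? k) then 1 else 0

-- s_{a,b}(n): coefficient of z^n in
--   f_{a,b}(z) = 1/((z^a - 1)(z^b - 1)) = 1/(1 - z^a) · 1/(1 - z^b),
-- computed as the Cauchy product of the two power series:
--   s_{a,b}(n) = Σ_{k=0}^{n} [z^k] 1/(1-z^a) · [z^(n-k)] 1/(1-z^b).
s : ℕ → ℕ → ℕ → ℕ
s a b n = sum (map (λ k → geomCoeff a k * geomCoeff b (n ∸ k)) (upTo (suc n)))

-- Each summand of s a b n is a product of two 0/1 coefficients, so s a b n is at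
-- most the number n + 1 of summands, with equality for a = b = 1.  For n ≥ 1 one
-- summand vanishes: the k = 1 term if 1 < a, the k = n - 1 term if 1 < b,
-- because a number greater than 1 does not divide 1.
module Submission where

open import Defs
open import Data.Nat using (ℕ; zero; suc; _≤_; _<_; _*_; _∸_; z≤n; s≤s)
open import Data.Nat.Properties
  using (≤-refl; <-irrefl; n≤1+n; m+n∸n≡m; *-mono-≤; *-zeroʳ; +-mono-≤; +-mono-≤-<)
open import Data.Nat.Divisibility using (_∣_; _∣?_; 1∣_; ∣1⇒≡1)
open import Data.Nat.ListAction using (sum)
open import Data.List using (List; []; _∷_; map; upTo; length)
open import Data.List.Properties using (length-upTo)
open import Data.List.Membership.Propositional using (_∈_)
open import Data.List.Membership.Propositional.Properties using (∈-upTo⁺)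
open import Data.List.Relation.Unary.Any using (here; there)
open import Relation.Nullary using (yes; no)
open import Data.Sum using (_⊎_; inj₁; inj₂)
open import Data.Product using (_×_; _,_; ∃-syntax)
open import Data.Empty using (⊥-elim)
open import Relation.Binary.PropositionalEquality using (_≡_; refl; sym; trans; cong; subst; module ≡-Reasoning)

sum-map-≤-length : (f : ℕ → ℕ) → (∀ k → f k ≤ 1) → (xs : List ℕ) →
                   sum (map f xs) ≤ length xs
sum-map-≤-length f f≤1 []       = z≤n
sum-map-≤-length f f≤1 (x ∷ xs) = +-mono-≤ (f≤1 x) (sum-map-≤-length f f≤1 xs)

sum-map-<-length : (f : ℕ → ℕ) → (∀ k → f k ≤ 1) → {k : ℕ} → (xs : List ℕ) →
                   k ∈ xs → f k ≡ 0 → sum (map f xs) < length xs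
sum-map-<-length f f≤1 (x ∷ xs) (here refl) fk≡0 rewrite fk≡0 =
  s≤s (sum-map-≤-length f f≤1 xs)
sum-map-<-length f f≤1 (x ∷ xs) (there k∈xs) fk≡0 =
  +-mono-≤-< (f≤1 x) (sum-map-<-length f f≤1 xs k∈xs fk≡0)

sum-map-const-1 : (f : ℕ → ℕ) → (∀ k → f k ≡ 1) → (xs : List ℕ) →
                  sum (map f xs) ≡ length xs
sum-map-const-1 f f≡1 []       = refl
sum-map-const-1 f f≡1 (x ∷ xs) rewrite f≡1 x = cong suc (sum-map-const-1 f f≡1 xs)

geomCoeff≤1 : ∀ a k → geomCoeff a k ≤ 1
geomCoeff≤1 a k with a ∣? k
... | yes _ = ≤-refl
... | no  _ = z≤n

geomCoeff-∣ : ∀ a k → a ∣ k → geomCoeff a k ≡ 1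
geomCoeff-∣ a k a∣k with a ∣? k
... | yes _   = refl
... | no  a∤k = ⊥-elim (a∤k a∣k)

geomCoeff-1 : ∀ k → geomCoeff 1 k ≡ 1
geomCoeff-1 k = geomCoeff-∣ 1 k (1∣ k)

geomCoeff-at-1 : ∀ a → 1 < a → geomCoeff a 1 ≡ 0
geomCoeff-at-1 a 1<a with a ∣? 1
... | yes a∣1 = ⊥-elim (<-irrefl (sym (∣1⇒≡1 a∣1)) 1<a)
... | no  _   = refl

term : ℕ → ℕ → ℕ → ℕ → ℕ
term a b n k = geomCoeff a k * geomCoeff b (n ∸ k)

term≤1 : ∀ a b n k → term a b n k ≤ 1
term≤1 a b n k = *-mono-≤ (geomCoeff≤1 a k) (geomCoeff≤1 b (n ∸ k))

s≤suc : ∀ a b n → s a b n ≤ suc n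
s≤suc a b n = subst (s a b n ≤_) (length-upTo (suc n))
  (sum-map-≤-length (term a b n) (term≤1 a b n) (upTo (suc n)))

s-1-1 : ∀ n → s 1 1 n ≡ suc n
s-1-1 n = trans (sum-map-const-1 (term 1 1 n) term-1-1 (upTo (suc n))) (length-upTo (suc n))
  where
  term-1-1 : ∀ k → term 1 1 n k ≡ 1
  term-1-1 k rewrite geomCoeff-1 k | geomCoeff-1 (n ∸ k) = refl

vanishing-term : ∀ a b m → (1 < a ⊎ 1 < b) → ∃[ k ] k ≤ suc m × term a b (suc m) k ≡ 0
vanishing-term a b m (inj₁ 1<a) =
  1 , s≤s z≤n , cong (_* geomCoeff b m) (geomCoeff-at-1 a 1<a)
vanishing-term a b m (inj₂ 1<b) = m , n≤1+n m , (begin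
  geomCoeff a m * geomCoeff b (suc m ∸ m) ≡⟨ cong (λ j → geomCoeff a m * geomCoeff b j) (m+n∸n≡m 1 m) ⟩
  geomCoeff a m * geomCoeff b 1           ≡⟨ cong (geomCoeff a m *_) (geomCoeff-at-1 b 1<b) ⟩
  geomCoeff a m * 0                       ≡⟨ *-zeroʳ (geomCoeff a m) ⟩
  0                                       ∎)
  where open ≡-Reasoning

s<suc : ∀ a b → (1 < a ⊎ 1 < b) → ∀ m → s a b (suc m) < suc (suc m)
s<suc a b 1<a⊎1<b m with vanishing-term a b m 1<a⊎1<b
... | k , k≤1+m , term≡0 = subst (s a b (suc m) <_) (length-upTo (suc (suc m)))
  (sum-map-<-length (term a b (suc m)) (term≤1 a b (suc m)) (upTo (suc (suc m)))
    (∈-upTo⁺ (s≤s k≤1+m)) term≡0)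

lemma5 : (a b : ℕ) → 1 ≤ a → 1 ≤ b → (1 < a ⊎ 1 < b) → (n : ℕ) →
    (s a b n ≤ s 1 1 n) × (s 1 1 n ≡ suc n) × (s a b n ≡ s 1 1 n → n ≡ 0)
lemma5 a b _ _ 1<a⊎1<b n =
  subst (s a b n ≤_) (sym (s-1-1 n)) (s≤suc a b n) , s-1-1 n , equality-only-at-0 n
  where
  equality-only-at-0 : ∀ n → s a b n ≡ s 1 1 n → n ≡ 0
  equality-only-at-0 zero    _   = refl
  equality-only-at-0 (suc m) s≡s =
    ⊥-elim (<-irrefl (trans s≡s (s-1-1 (suc m))) (s<suc a b 1<a⊎1<b m))
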